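{- Let $B=B'(p)$ be the base-polyhedron defined by an integer-valued supermodular function $p$ on $S$ with $p(\emptyset)=0$. Then the maximum in the min-max formula $$\min\left\{\sum_{s\in S}m(s)^2: m\in B\cap\mathbb{Z}^S\right\}=\max\left\{\hat p(\pi)-\sum_{s\in S}\left\lfloor\frac{\pi(s)}{2}\right\rfloor\left\lceil\frac{\pi(s)}{2}\right\rceil:\pi\in\mathbb{Z}^S\right\}$$ is attained by an odd vector $\pi$, i.e. $$\min\left\{\sum_{s\in S}m(s)^2: m\in B\cap\mathbb{Z}^S\right\}=\max\left\{\hat p(\pi)-\sum_{s\in S}\frac{\pi(s)^2-1}{4}:\pi\in\mathbb{Z}^S,\ \pi\text{ odd}\right\}.$$
   Context: $S$ is a finite non-empty set of $n$ elements; $p$ supermodular means $p(X)+p(Y)\le p(X\cap Y)+p(X\cup Y)$ for all $X,Y\subseteq S$. $B'(p)=\{x\in\mathbb{R}^S:\widetilde x(S)=p(S),\ \widetilde x(Z)\ge p(Z)\ \forall Z\subset S\}$, $\widetilde x(Z)=\sum_{s\in Z}x(s)$. Linear extension: for $\pi\in\mathbb{R}^S$, index $S=\{s_1,\dots,s_n\}$ so that $\pi(s_1)\ge\dots\ge\pi(s_n)$ (ties arbitrarily), let $I_j=\{s_1,\dots,s_j\}$ and $\hat p(\pi):=p(I_n)\pi(s_n)+\sum_{j=1}^{n-1}p(I_j)[\pi(s_j)-\pi(s_{j+1})]$. An integral vector $\pi$ is odd if every component is an odd integer. -}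

module Defs where

open import Data.Nat using (ℕ; zero; suc)
open import Data.Bool using (Bool; true; false; if_then_else_)
open import Data.Integer using (ℤ; +_; _+_; _-_; _*_; -_; _≤_; _/_)
open import Data.Fin using (Fin)
import Data.Fin as F
open import Data.Fin.Subset using (Subset; ⊥; ⊤; _∩_; _∪_; ⁅_⁆)
open import Data.List using (List; []; _∷_)
open import Data.List.Base using (allFin)
open import Data.Vec using (Vec; []; _∷_)
open import Data.Product using (Σ; _×_)
open import Relation.Binary.PropositionalEquality using (_≡_; _≢_)
open import Relation.Nullary using (does)
open import Data.Integer.Properties using (_≤?_)

sumOver : ∀ {n} → Subset n → (Fin n → ℤ) → ℤ
sumOver [] x = + 0
sumOver (b ∷ Z) x = (if b then x F.zero else + 0) + sumOver Z (λ i → x (F.suc i))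

sumAll : ∀ {n} → (Fin n → ℤ) → ℤ
sumAll = sumOver ⊤

Supermodular : ∀ {n} → (Subset n → ℤ) → Set
Supermodular p = ∀ X Y → p X + p Y ≤ p (X ∩ Y) + p (X ∪ Y)

InB' : ∀ {n} → (Subset n → ℤ) → (Fin n → ℤ) → Set
InB' p x = (sumOver ⊤ x ≡ p ⊤) × (∀ Z → Z ≢ ⊤ → p Z ≤ sumOver Z x)

-- ordering s₁,…,sₙ with π(s₁) ≥ … ≥ π(sₙ): insertion sort, descending
insertDesc : ∀ {n} → (Fin n → ℤ) → Fin n → List (Fin n) → List (Fin n)
insertDesc π s [] = s ∷ []
insertDesc π s (t ∷ ts) =
  if does (π t ≤? π s) then s ∷ t ∷ ts else t ∷ insertDesc π s ts

sortDesc : ∀ {n} → (Fin n → ℤ) → List (Fin n) → List (Fin n)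
sortDesc π [] = []
sortDesc π (s ∷ ss) = insertDesc π s (sortDesc π ss)

-- given the prefix I_{j-1} (acc) and the remaining ordered elements s_j,…,s_n,
-- computes  Σ_{k≥j, k<n} p(I_k)[π(s_k) - π(s_{k+1})] + p(I_n) π(s_n)
hatGo : ∀ {n} → (Subset n → ℤ) → (Fin n → ℤ) → Subset n → List (Fin n) → ℤ
hatGo p π acc [] = + 0
hatGo p π acc (s ∷ []) = p (acc ∪ ⁅ s ⁆) * π s
hatGo p π acc (s ∷ t ∷ rest) =
  p (acc ∪ ⁅ s ⁆) * (π s - π t) + hatGo p π (acc ∪ ⁅ s ⁆) (t ∷ rest)

hatP : ∀ {n} → (Subset n → ℤ) → (Fin n → ℤ) → ℤ
hatP {n} p π = hatGo p π ⊥ (sortDesc π (allFin n))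

-- ⌊ k / 2 ⌋ and ⌈ k / 2 ⌉  (ℤ division by a positive divisor is floor division)
floorHalf : ℤ → ℤ
floorHalf k = k / (+ 2)

ceilHalf : ℤ → ℤ
ceilHalf k = - ((- k) / (+ 2))

-- (k² - 1) / 4  (exact for odd k)
quarterSqM1 : ℤ → ℤ
quarterSqM1 k = (k * k - + 1) / (+ 4)

val1 : ∀ {n} → (Subset n → ℤ) → (Fin n → ℤ) → ℤ
val1 p π = hatP p π - sumAll (λ s → floorHalf (π s) * ceilHalf (π s))

val2 : ∀ {n} → (Subset n → ℤ) → (Fin n → ℤ) → ℤ
val2 p π = hatP p π - sumAll (λ s → quarterSqM1 (π s))

OddInt : ℤ → Set
OddInt k = Σ ℤ (λ j → k ≡ + 2 * j + + 1)

OddVec : ∀ {n} → (Fin n → ℤ) → Set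
OddVec π = ∀ s → OddInt (π s)

sumSq : ∀ {n} → (Fin n → ℤ) → ℤ
sumSq m = sumAll (λ s → m s * m s)

-- Weak duality holds term by term.  For m ∈ B'(p), summing p̂(π) by parts along the order of π
-- gives p̂(π) ≤ Σ π(s) m(s), since all cut coefficients π(sⱼ) - π(sⱼ₊₁) are nonnegative; and
-- π m ≤ m² + ⌊π/2⌋⌈π/2⌉ for all integers, because no integer lies strictly between ⌊π/2⌋ and ⌈π/2⌉.
-- For equality take an integral m ∈ B'(p) that cannot be improved by moving a unit from i to j
-- whenever m(i) ≥ m(j) + 2; then such i and j are separated by a tight set.  Let π(i) = 2 m(i) + 1
-- if tight sets separate i from every j with m(j) < m(i), and π(i) = 2 m(i) - 1 otherwise.  Then
-- π(j) < π(i) forces a tight set containing i but not j; tight sets form a lattice, so every upper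
-- level set of π is tight, which makes p̂(π) = Σ π(s) m(s).  As π(s) = 2 m(s) ± 1 is odd, both
-- inequalities are equalities, and ⌊π/2⌋⌈π/2⌉ = (π² - 1)/4.

module Submission where

open import Defs
open import Data.Nat using (ℕ)
import Data.Nat as N
open import Data.Integer using (ℤ; +_; _≤_)
open import Data.Fin using (Fin)
open import Data.Fin.Subset using (Subset; ⊥)
open import Data.Product using (Σ; _×_)
open import Relation.Binary.PropositionalEquality using (_≡_)

open import Data.Bool using (Bool; true; false; if_then_else_; _∧_; _∨_)
open import Data.Bool.Properties using (∨-identityʳ) renaming (_≟_ to _≟ᵇ_)
open import Data.Empty using (⊥-elim)
open import Data.Fin using (zero; suc; _≟_)
open import Data.Fin.Properties using (any?; all?; ¬∀⟶∃¬)
open import Data.Fin.Subset using (⊤; _∩_; _∪_; ⁅_⁆; _∈_; _∉_; _⊆_; ⋂; ⋃)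
open import Data.Fin.Subset.Properties
  using (_∈?_; anySubset?; ∈⊤; ∉⊥; ⊆⊤; ⊆-antisym; x∈⁅x⁆; x∈⁅y⁆⇒x≡y; x∈p∩q⁺; x∈p∩q⁻; x∈p∪q⁺; x∈p∪q⁻)
open import Data.Integer using (∣_∣; _+_; _-_; _*_; -_; _/_; _%_; _<_; +<+; +≤+; nonNegative)
  renaming (suc to sucℤ)
open import Data.Integer.DivMod using ([n/d]*d≤n; n<s[n/ℕd]*d; div-pos-is-/ℕ; a≡a%n+[a/n]*n; n%d<d)
open import Data.Integer.Properties renaming (_≟_ to _≟ℤ_)
open import Data.Integer.Tactic.RingSolver using (solve-∀; solve)
open import Data.List using (List; []; _∷_; foldr; map; tabulate; allFin)
open import Data.List.Membership.Propositional using () renaming (_∈_ to _∈ˡ_)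
open import Data.List.Properties using (map-tabulate)
open import Data.List.Relation.Binary.Permutation.Propositional
  using (_↭_; ↭-refl; ↭-sym; ↭-prep; ↭-swap; ↭-trans; ↭⇒↭ₛ)
open import Data.List.Relation.Binary.Permutation.Propositional.Properties using (map⁺)
open import Data.Nat.Properties using (n<1+n)
open import Data.Product using (_,_; ∃; proj₁; proj₂)
open import Data.Sum using (_⊎_; inj₁; inj₂)
open import Data.Vec.Properties using (≡-dec)
open import Function using (_∘_; id; const; case_of_)
open import Function.Bundles using (_⇔_; mk⇔; Equivalence)
open import Relation.Binary.PropositionalEquality
  using (_≢_; refl; sym; trans; cong; cong₂; subst; subst₂; module ≡-Reasoning)
open import Relation.Binary.PropositionalEquality.Properties using (setoid)
open import Relation.Nullary using (¬_; Dec; yes; no; does; ¬?; _×-dec_; _→-dec_)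
open import Relation.Nullary.Decidable using (decidable-stable)

i<suc[j]⇒i≤j : ∀ {i j} → i < sucℤ j → i ≤ j
i<suc[j]⇒i≤j {i} {j} i<sj = subst (i ≤_) (pred-suc j) (i<j⇒i≤pred[j] i<sj)

i<j⇒i+1≤j : ∀ {i j} → i < j → i + + 1 ≤ j
i<j⇒i+1≤j {i} i<j = subst (_≤ _) (+-comm (+ 1) i) (i<j⇒suc[i]≤j i<j)

/-unique : ∀ a {q : ℤ} {r d : ℕ} .{{_ : N.NonZero d}} →
           r N.< d → a ≡ + r + q * + d → a / + d ≡ q
/-unique a {q} {r} {d} r<d a≡r+qd =
  ≤-antisym (bracket ([n/d]*d≤n a (+ d)) a<[q+1]d) (bracket qd≤a a<[a/d+1]d)
  where
  open ≤-Reasoning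
  bracket : ∀ {k k′} → k * + d ≤ a → a < sucℤ k′ * + d → k ≤ k′
  bracket kd≤a a<[k′+1]d = i<suc[j]⇒i≤j (*-cancelʳ-<-nonNeg (+ d) (≤-<-trans kd≤a a<[k′+1]d))
  qd≤a : q * + d ≤ a
  qd≤a = begin
    q * + d       ≤⟨ i≤j+i _ (+ r) ⟩
    + r + q * + d ≡⟨ sym a≡r+qd ⟩
    a             ∎
  a<[q+1]d : a < sucℤ q * + d
  a<[q+1]d = begin-strict
    a             ≡⟨ a≡r+qd ⟩
    + r + q * + d <⟨ +-monoˡ-< (q * + d) (+<+ r<d) ⟩
    + d + q * + d ≡⟨ sym (suc-* q (+ d)) ⟩
    sucℤ q * + d  ∎
  a<[a/d+1]d : a < sucℤ (a / + d) * + d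
  a<[a/d+1]d = subst (λ k → a < sucℤ k * + d) (sym (div-pos-is-/ℕ a d)) (n<s[n/ℕd]*d a d)

+-squeeze : ∀ {a A b B} → a ≤ A → b ≤ B → A + B ≤ a + b → a ≡ A
+-squeeze {a} {A} {b} {B} a≤A b≤B A+B≤a+b = sym (i-j≡0⇒i≡j A a (≤-antisym A-a≤0 (i≤j⇒0≤j-i a≤A)))
  where
  open ≤-Reasoning
  A-a≤0 : A - a ≤ + 0
  A-a≤0 = begin
    A - a                 ≤⟨ i≤i+j (A - a) (B - b) {{nonNegative (i≤j⇒0≤j-i b≤B)}} ⟩
    (A - a) + (B - b)     ≡⟨ solve (A ∷ a ∷ B ∷ b ∷ []) ⟩
    (A + B) - (a + b)     ≤⟨ i≤j⇒i-j≤0 A+B≤a+b ⟩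
    + 0                   ∎

[a+b]-b≡a : ∀ a b → a + b - b ≡ a
[a+b]-b≡a a b = solve (a ∷ b ∷ [])

0≤i∧0≤j⇒0≤i*j : ∀ {i j} → + 0 ≤ i → + 0 ≤ j → + 0 ≤ i * j
0≤i∧0≤j⇒0≤i*j {i} {j} 0≤i 0≤j = *-monoʳ-≤-nonNeg j {{nonNegative 0≤j}} 0≤i

square-nonneg : ∀ i → + 0 ≤ i * i
square-nonneg i with + 0 ≤? i
... | yes 0≤i = 0≤i∧0≤j⇒0≤i*j 0≤i 0≤i
... | no  0≰i = subst (+ 0 ≤_) (neg-*-neg i) (0≤i∧0≤j⇒0≤i*j -i≥0 -i≥0)
  where -i≥0 = neg-mono-≤ (<⇒≤ (≰⇒> 0≰i))
        neg-*-neg : ∀ i → - i * - i ≡ i * i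
        neg-*-neg = solve-∀

2a+c≤2b+c : ∀ {a b} → a ≤ b → ∀ c → + 2 * a + c ≤ + 2 * b + c
2a+c≤2b+c a≤b c = +-monoˡ-≤ c (*-monoˡ-≤-nonNeg (+ 2) a≤b)

2a+1≤2b-1 : ∀ {a b} → a < b → + 2 * a + + 1 ≤ + 2 * b - + 1
2a+1≤2b-1 {a} {b} a<b = begin
  + 2 * a + + 1            ≡⟨ solve (a ∷ []) ⟩
  + 2 * (+ 1 + a) - + 1    ≤⟨ +-monoˡ-≤ (- + 1) (*-monoˡ-≤-nonNeg (+ 2) (i<j⇒suc[i]≤j a<b)) ⟩
  + 2 * b - + 1            ∎
  where open ≤-Reasoning

2a-1≤2b+1 : ∀ {a b} → a ≤ b + + 1 → + 2 * a - + 1 ≤ + 2 * b + + 1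
2a-1≤2b+1 {a} {b} a≤b+1 = begin
  + 2 * a - + 1            ≤⟨ +-monoˡ-≤ (- + 1) (*-monoˡ-≤-nonNeg (+ 2) a≤b+1) ⟩
  + 2 * (b + + 1) - + 1    ≡⟨ solve (b ∷ []) ⟩
  + 2 * b + + 1            ∎
  where open ≤-Reasoning

-- Halving: ⌊k/2⌋⌈k/2⌉

even-or-odd : ∀ k → ∃ λ j → k ≡ + 2 * j ⊎ k ≡ + 2 * j + + 1
even-or-odd k with k % + 2 | a≡a%n+[a/n]*n k (+ 2) | n%d<d k (+ 2)
... | 0 | k≡0+j*2 | _ = k / + 2 , inj₁ (trans k≡0+j*2 (0+j*2≡2*j (k / + 2)))
  where 0+j*2≡2*j : ∀ j → + 0 + j * + 2 ≡ + 2 * j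
        0+j*2≡2*j = solve-∀
... | 1 | k≡1+j*2 | _ = k / + 2 , inj₂ (trans k≡1+j*2 (1+j*2≡2*j+1 (k / + 2)))
  where 1+j*2≡2*j+1 : ∀ j → + 1 + j * + 2 ≡ + 2 * j + + 1
        1+j*2≡2*j+1 = solve-∀
... | N.suc (N.suc _) | _ | N.s≤s (N.s≤s ())

floorHalf-even : ∀ j → floorHalf (+ 2 * j) ≡ j
floorHalf-even j = /-unique (+ 2 * j) {r = 0} {d = 2} (N.s≤s N.z≤n) (solve (j ∷ []))

ceilHalf-even : ∀ j → ceilHalf (+ 2 * j) ≡ j
ceilHalf-even j = begin
  - (- (+ 2 * j) / + 2) ≡⟨ cong -_ (/-unique (- (+ 2 * j)) {q = - j} {r = 0} {d = 2} (N.s≤s N.z≤n) (solve (j ∷ []))) ⟩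
  - - j                 ≡⟨ neg-involutive j ⟩
  j                     ∎
  where open ≡-Reasoning

floorHalf-odd : ∀ j → floorHalf (+ 2 * j + + 1) ≡ j
floorHalf-odd j = /-unique (+ 2 * j + + 1) {r = 1} {d = 2} (N.s≤s (N.s≤s N.z≤n)) (solve (j ∷ []))

ceilHalf-odd : ∀ j → ceilHalf (+ 2 * j + + 1) ≡ j + + 1
ceilHalf-odd j = begin
  - (- (+ 2 * j + + 1) / + 2)
    ≡⟨ cong -_ (/-unique (- (+ 2 * j + + 1)) {q = - j - + 1} {r = 1} {d = 2} (N.s≤s (N.s≤s N.z≤n)) (solve (j ∷ []))) ⟩
  - (- j - + 1)
    ≡⟨ solve (j ∷ []) ⟩
  j + + 1
    ∎
  where open ≡-Reasoning

quarterSqM1-odd : ∀ j → quarterSqM1 (+ 2 * j + + 1) ≡ j * (j + + 1)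
quarterSqM1-odd j = /-unique ((+ 2 * j + + 1) * (+ 2 * j + + 1) - + 1) {r = 0} {d = 4} (N.s≤s N.z≤n) (solve (j ∷ []))

floorHalf*ceilHalf≡quarterSqM1 : ∀ {k} → OddInt k → floorHalf k * ceilHalf k ≡ quarterSqM1 k
floorHalf*ceilHalf≡quarterSqM1 (j , refl) = begin
  floorHalf (+ 2 * j + + 1) * ceilHalf (+ 2 * j + + 1) ≡⟨ cong₂ _*_ (floorHalf-odd j) (ceilHalf-odd j) ⟩
  j * (j + + 1)                                       ≡⟨ sym (quarterSqM1-odd j) ⟩
  quarterSqM1 (+ 2 * j + + 1)                         ∎
  where open ≡-Reasoning

adjacent⇒0≤[m-f]*[m-c] : ∀ {f c} → f ≤ c → c ≤ sucℤ f → ∀ m → + 0 ≤ (m - f) * (m - c)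
adjacent⇒0≤[m-f]*[m-c] {f} {c} f≤c c≤f+1 m with m ≤? f
... | yes m≤f = begin
  + 0               ≤⟨ 0≤i∧0≤j⇒0≤i*j (i≤j⇒0≤j-i m≤f) (i≤j⇒0≤j-i (≤-trans m≤f f≤c)) ⟩
  (f - m) * (c - m) ≡⟨ solve (m ∷ f ∷ c ∷ []) ⟩
  (m - f) * (m - c) ∎
  where open ≤-Reasoning
... | no m≰f = 0≤i∧0≤j⇒0≤i*j (i≤j⇒0≤j-i (<⇒≤ f<m)) (i≤j⇒0≤j-i (≤-trans c≤f+1 (i<j⇒suc[i]≤j f<m)))
  where f<m = ≰⇒> m≰f

adjacent-product-bound : ∀ {k f c} → k ≡ f + c → f ≤ c → c ≤ sucℤ f →
                         ∀ m → k * m ≤ m * m + f * c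
adjacent-product-bound {k} {f} {c} refl f≤c c≤f+1 m =
  0≤i-j⇒j≤i (begin
    + 0                                  ≤⟨ adjacent⇒0≤[m-f]*[m-c] f≤c c≤f+1 m ⟩
    (m - f) * (m - c)                    ≡⟨ solve (m ∷ f ∷ c ∷ []) ⟩
    (m * m + f * c) - (f + c) * m        ∎)
  where open ≤-Reasoning

product≤square+floorHalf*ceilHalf : ∀ k m → k * m ≤ m * m + floorHalf k * ceilHalf k
product≤square+floorHalf*ceilHalf k m with even-or-odd k
... | j , inj₁ refl = begin
  + 2 * j * m
    ≤⟨ adjacent-product-bound {+ 2 * j} {j} {j} (solve (j ∷ [])) ≤-refl (i≤suc[i] j) m ⟩
  m * m + j * j
    ≡⟨ cong (_+_ (m * m)) (sym (cong₂ _*_ (floorHalf-even j) (ceilHalf-even j))) ⟩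
  m * m + floorHalf (+ 2 * j) * ceilHalf (+ 2 * j)
    ∎
  where open ≤-Reasoning
... | j , inj₂ refl = begin
  (+ 2 * j + + 1) * m
    ≤⟨ adjacent-product-bound {+ 2 * j + + 1} {j} {j + + 1} (solve (j ∷ [])) (i≤i+j j (+ 1)) (≤-reflexive (+-comm j (+ 1))) m ⟩
  m * m + j * (j + + 1)
    ≡⟨ cong (_+_ (m * m)) (sym (cong₂ _*_ (floorHalf-odd j) (ceilHalf-odd j))) ⟩
  m * m + floorHalf (+ 2 * j + + 1) * ceilHalf (+ 2 * j + + 1)
    ∎
  where open ≤-Reasoning

[2a±1]*a≡a*a+quarterSqM1 : ∀ a k → k ≡ + 2 * a + + 1 ⊎ k ≡ + 2 * a - + 1 → k * a ≡ a * a + quarterSqM1 k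
[2a±1]*a≡a*a+quarterSqM1 a k (inj₁ refl) = begin
  (+ 2 * a + + 1) * a                      ≡⟨ solve (a ∷ []) ⟩
  a * a + a * (a + + 1)                    ≡⟨ cong (_+_ (a * a)) (sym (quarterSqM1-odd a)) ⟩
  a * a + quarterSqM1 (+ 2 * a + + 1)      ∎
  where open ≡-Reasoning
[2a±1]*a≡a*a+quarterSqM1 a k (inj₂ refl) = begin
  (+ 2 * a - + 1) * a                      ≡⟨ solve (a ∷ []) ⟩
  a * a + (a - + 1) * ((a - + 1) + + 1)    ≡⟨ cong (_+_ (a * a)) (sym (quarterSqM1-odd (a - + 1))) ⟩
  a * a + quarterSqM1 (+ 2 * (a - + 1) + + 1) ≡⟨ cong (λ k → a * a + quarterSqM1 k) (odd-shift a) ⟩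
  a * a + quarterSqM1 (+ 2 * a - + 1)      ∎
  where open ≡-Reasoning
        odd-shift : ∀ a → + 2 * (a - + 1) + + 1 ≡ + 2 * a - + 1
        odd-shift = solve-∀

-- Sums over subsets and the base polyhedron

single : ∀ {n} → Fin n → ℤ → Fin n → ℤ
single j c v = if does (v ≟ j) then c else + 0

module _ where
  open import Data.Vec using ([]; _∷_; here; there)
  open import Data.Fin.Subset.Properties using (∪-identityʳ)
  open import Algebra.Properties.CommutativeSemigroup +-commutativeSemigroup using (interchange)

  private
    head : Bool → ℤ → ℤ
    head b a = if b then a else + 0

    head-0 : ∀ b → head b (+ 0) ≡ + 0
    head-0 true  = refl
    head-0 false = refl

  sumOver-cong : ∀ {n} (Z : Subset n) {f g : Fin n → ℤ} → (∀ i → f i ≡ g i) → sumOver Z f ≡ sumOver Z g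
  sumOver-cong []      f≗g = refl
  sumOver-cong (b ∷ Z) f≗g = cong₂ _+_ (cong (head b) (f≗g zero)) (sumOver-cong Z (f≗g ∘ suc))

  sumOver-+ : ∀ {n} (Z : Subset n) (f g : Fin n → ℤ) →
              sumOver Z (λ i → f i + g i) ≡ sumOver Z f + sumOver Z g
  sumOver-+ []      f g = refl
  sumOver-+ (b ∷ Z) f g = begin
    head b (f zero + g zero) + sumOver Z (λ i → f (suc i) + g (suc i))
      ≡⟨ cong₂ _+_ (head-+ b) (sumOver-+ Z (f ∘ suc) (g ∘ suc)) ⟩
    (head b (f zero) + head b (g zero)) + (sumOver Z (f ∘ suc) + sumOver Z (g ∘ suc))
      ≡⟨ interchange (head b (f zero)) (head b (g zero)) (sumOver Z (f ∘ suc)) (sumOver Z (g ∘ suc)) ⟩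
    (head b (f zero) + sumOver Z (f ∘ suc)) + (head b (g zero) + sumOver Z (g ∘ suc)) ∎
    where
    open ≡-Reasoning
    head-+ : ∀ b → head b (f zero + g zero) ≡ head b (f zero) + head b (g zero)
    head-+ true  = refl
    head-+ false = refl

  sumOver-mono : ∀ {n} (Z : Subset n) {f g : Fin n → ℤ} → (∀ i → f i ≤ g i) → sumOver Z f ≤ sumOver Z g
  sumOver-mono []          f≤g = ≤-refl
  sumOver-mono (true ∷ Z)  f≤g = +-mono-≤ (f≤g zero) (sumOver-mono Z (f≤g ∘ suc))
  sumOver-mono (false ∷ Z) f≤g = +-monoʳ-≤ (+ 0) (sumOver-mono Z (f≤g ∘ suc))

  sumOver-0 : ∀ {n} (Z : Subset n) → sumOver Z (λ _ → + 0) ≡ + 0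
  sumOver-0 []      = refl
  sumOver-0 (b ∷ Z) = cong₂ _+_ (head-0 b) (sumOver-0 Z)

  sumOver-⊥ : ∀ {n} (f : Fin n → ℤ) → sumOver ⊥ f ≡ + 0
  sumOver-⊥ {N.zero}  f = refl
  sumOver-⊥ {N.suc n} f = trans (+-identityˡ (sumOver ⊥ (f ∘ suc))) (sumOver-⊥ (f ∘ suc))

  sumOver-modular : ∀ {n} (X Y : Subset n) (f : Fin n → ℤ) →
                    sumOver X f + sumOver Y f ≡ sumOver (X ∩ Y) f + sumOver (X ∪ Y) f
  sumOver-modular []      []      f = refl
  sumOver-modular (x ∷ X) (y ∷ Y) f = begin
    (head x a + S X) + (head y a + S Y)                  ≡⟨ interchange (head x a) (S X) (head y a) (S Y) ⟩
    (head x a + head y a) + (S X + S Y)                  ≡⟨ cong₂ _+_ (heads x y) (sumOver-modular X Y (f ∘ suc)) ⟩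
    (head (x ∧ y) a + head (x ∨ y) a) + (S (X ∩ Y) + S (X ∪ Y))
      ≡⟨ interchange (head (x ∧ y) a) (head (x ∨ y) a) (S (X ∩ Y)) (S (X ∪ Y)) ⟩
    (head (x ∧ y) a + S (X ∩ Y)) + (head (x ∨ y) a + S (X ∪ Y)) ∎
    where
    open ≡-Reasoning
    a = f zero
    S = λ Z → sumOver Z (f ∘ suc)
    heads : ∀ x y → head x a + head y a ≡ head (x ∧ y) a + head (x ∨ y) a
    heads true  true  = refl
    heads true  false = +-comm a (+ 0)
    heads false y     = refl

  sumOver-∪⁅⁆ : ∀ {n} (X : Subset n) {s} (f : Fin n → ℤ) → s ∉ X → sumOver (X ∪ ⁅ s ⁆) f ≡ sumOver X f + f s
  sumOver-∪⁅⁆ (true  ∷ X) {zero}  f s∉X = ⊥-elim (s∉X here)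
  sumOver-∪⁅⁆ (false ∷ X) {zero}  f s∉X = begin
    f zero + sumOver (X ∪ ⊥) (f ∘ suc)  ≡⟨ cong (λ Y → f zero + sumOver Y (f ∘ suc)) (∪-identityʳ X) ⟩
    f zero + sumOver X (f ∘ suc)        ≡⟨ +-comm (f zero) (sumOver X (f ∘ suc)) ⟩
    sumOver X (f ∘ suc) + f zero        ≡⟨ cong (_+ f zero) (sym (+-identityˡ (sumOver X (f ∘ suc)))) ⟩
    + 0 + sumOver X (f ∘ suc) + f zero  ∎
    where open ≡-Reasoning
  sumOver-∪⁅⁆ (b ∷ X) {suc s} f s∉X = begin
    head (b ∨ false) (f zero) + sumOver (X ∪ ⁅ s ⁆) (f ∘ suc) ≡⟨ cong₂ _+_ (cong (λ c → head c (f zero)) (∨-identityʳ b))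
                                                                          (sumOver-∪⁅⁆ X (f ∘ suc) (s∉X ∘ there)) ⟩
    head b (f zero) + (sumOver X (f ∘ suc) + f (suc s))       ≡⟨ sym (+-assoc (head b (f zero)) (sumOver X (f ∘ suc)) (f (suc s))) ⟩
    head b (f zero) + sumOver X (f ∘ suc) + f (suc s)         ∎
    where open ≡-Reasoning

  sumOver-single-∈ : ∀ {n} (Z : Subset n) {j} c → j ∈ Z → sumOver Z (single j c) ≡ c
  sumOver-single-∈ (true ∷ Z) {zero}  c here = trans (cong (_+_ c) (sumOver-0 Z)) (+-identityʳ c)
  sumOver-single-∈ (b ∷ Z)    {suc j} c (there j∈Z) =
    trans (cong₂ _+_ (head-0 b) (sumOver-single-∈ Z c j∈Z)) (+-identityˡ c)

  sumOver-single-∉ : ∀ {n} (Z : Subset n) {j} c → j ∉ Z → sumOver Z (single j c) ≡ + 0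
  sumOver-single-∉ (true ∷ Z)  {zero}  c j∉Z = ⊥-elim (j∉Z here)
  sumOver-single-∉ (false ∷ Z) {zero}  c j∉Z = cong (_+_ (+ 0)) (sumOver-0 Z)
  sumOver-single-∉ (b ∷ Z)    {suc j} c j∉Z = cong₂ _+_ (head-0 b) (sumOver-single-∉ Z c (j∉Z ∘ there))

sumSq-nonneg : ∀ {n} (m : Fin n → ℤ) → + 0 ≤ sumSq m
sumSq-nonneg {n} m = subst (_≤ sumSq m) (sumOver-0 (⊤ {n})) (sumOver-mono ⊤ (λ i → square-nonneg (m i)))

InB'⇒lowerBound : ∀ {n} {p : Subset n → ℤ} {x} → InB' p x → ∀ Z → p Z ≤ sumOver Z x
InB'⇒lowerBound (x[S]≡p[S] , lowerBound) Z with ≡-dec _≟ᵇ_ Z ⊤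
... | yes refl = ≤-reflexive (sym x[S]≡p[S])
... | no Z≢S   = lowerBound Z Z≢S

module _ where
  open import Data.Vec using ([]; _∷_)
  open import Data.Fin.Subset.Properties using (∩-identityʳ; ∪-zeroʳ)

  -- The greedy point: x(s₀) = p(S) - p(S - s₀), then recursively a point of B'(p) restricted to S - s₀.
  B'-nonempty : ∀ {n} (p : Subset n → ℤ) → Supermodular p → p ⊥ ≡ + 0 → Σ (Fin n → ℤ) (InB' p)
  B'-nonempty {N.zero}  p _        p[∅]≡0 = (λ ()) , sym p[∅]≡0 , λ { [] []≢[] → ⊥-elim ([]≢[] refl) }
  B'-nonempty {N.suc n} p superMod p[∅]≡0
    with B'-nonempty (λ Z → p (false ∷ Z)) (λ X Y → superMod (false ∷ X) (false ∷ Y)) p[∅]≡0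
  ... | x′ , x′∈B′ = x , x[S]≡p[S] , λ Z _ → lowerBound Z
    where
    lowerBound′ = InB'⇒lowerBound x′∈B′
    x : Fin (N.suc n) → ℤ
    x zero    = p ⊤ - p (false ∷ ⊤)
    x (suc i) = x′ i
    rearrange : ∀ a b c d → a + b ≤ c + d → a ≤ (d - b) + c
    rearrange a b c d a+b≤c+d = subst₂ _≤_ ([a+b]-b≡a a b) (cd-b b c d) (+-monoˡ-≤ (- b) a+b≤c+d)
      where cd-b : ∀ b c d → c + d - b ≡ (d - b) + c
            cd-b = solve-∀
    lowerBound : ∀ Z → p Z ≤ sumOver Z x
    lowerBound (false ∷ Z) = ≤-trans (lowerBound′ Z) (≤-reflexive (sym (+-identityˡ (sumOver Z x′))))
    lowerBound (true ∷ Z)  = ≤-trans (rearrange (p (true ∷ Z)) (p (false ∷ ⊤)) (p (false ∷ Z)) (p ⊤) submod)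
                                     (+-monoʳ-≤ (x zero) (lowerBound′ Z))
      where submod : p (true ∷ Z) + p (false ∷ ⊤) ≤ p (false ∷ Z) + p ⊤
            submod = subst₂ (λ A B → p (true ∷ Z) + p (false ∷ ⊤) ≤ p (false ∷ A) + p (true ∷ B))
                       (∩-identityʳ Z) (∪-zeroʳ Z) (superMod (true ∷ Z) (false ∷ ⊤))
    x[S]≡p[S] : sumAll x ≡ p ⊤
    x[S]≡p[S] = trans (cong (_+_ (x zero)) (proj₁ x′∈B′)) (minus-plus (p ⊤) (p (false ∷ ⊤)))
      where minus-plus : ∀ a b → (a - b) + b ≡ a
            minus-plus = solve-∀

-- The linear extension p̂

sumList : ∀ {n} → List (Fin n) → (Fin n → ℤ) → ℤ
sumList L f = foldr _+_ (+ 0) (map f L)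

sumList-allFin : ∀ {n} (f : Fin n → ℤ) → sumList (allFin n) f ≡ sumAll f
sumList-allFin f = trans (cong (foldr _+_ (+ 0)) (map-tabulate id f)) (sum-tabulate f)
  where
  sum-tabulate : ∀ {n} (f : Fin n → ℤ) → foldr _+_ (+ 0) (tabulate f) ≡ sumAll f
  sum-tabulate {N.zero}  f = refl
  sum-tabulate {N.suc n} f = cong (_+_ (f zero)) (sum-tabulate (f ∘ suc))

sumList-↭ : ∀ {n} {L L′ : List (Fin n)} (f : Fin n → ℤ) → L ↭ L′ → sumList L f ≡ sumList L′ f
sumList-↭ f L↭L′ = foldr-commMonoid +-0-isCommutativeMonoid (↭⇒↭ₛ (map⁺ f L↭L′))
  where open import Data.List.Relation.Binary.Permutation.Setoid.Properties (setoid ℤ) using (foldr-commMonoid)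

UpperLevelSet : ∀ {n} → (Fin n → ℤ) → ℤ → Subset n → Set
UpperLevelSet π c Z = ∀ i → i ∈ Z ⇔ c ≤ π i

module LinearExtension {n} (π : Fin n → ℤ) where
  open import Data.List.Relation.Unary.Linked using (Linked; []; [-]; _∷_)
  open import Data.List.Relation.Unary.Linked.Properties using (Linked⇒All)
  open import Data.List.Relation.Unary.Any using (here; there)
  open import Data.List.Relation.Unary.All as All using (All; []; _∷_)
  open import Data.List.Relation.Unary.Unique.Propositional using (Unique)
  open import Data.List.Relation.Unary.Unique.Propositional.Properties using (allFin⁺)
  open import Data.List.Relation.Unary.AllPairs using (_∷_)
  open import Data.List.Relation.Binary.Permutation.Setoid.Properties (setoid (Fin n)) using (Unique-resp-↭)
  open import Data.List.Relation.Binary.Permutation.Propositional.Properties using (∈-resp-↭)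
  open import Data.List.Membership.Propositional.Properties using (∈-allFin)

  Descending : List (Fin n) → Set
  Descending = Linked (λ s t → π t ≤ π s)

  insertDesc-below : ∀ {t} s L → π s ≤ π t → Descending (t ∷ L) → Descending (t ∷ insertDesc π s L)
  insertDesc-below s []      s≤t [-]         = s≤t ∷ [-]
  insertDesc-below s (u ∷ L) s≤t (u≤t ∷ desc) with π u ≤? π s
  ... | yes u≤s = s≤t ∷ u≤s ∷ desc
  ... | no  u≰s = u≤t ∷ insertDesc-below s L (<⇒≤ (≰⇒> u≰s)) desc

  insertDesc-descending : ∀ s L → Descending L → Descending (insertDesc π s L)
  insertDesc-descending s []      []   = [-]
  insertDesc-descending s (t ∷ L) desc with π t ≤? π s
  ... | yes t≤s = t≤s ∷ desc
  ... | no  t≰s = insertDesc-below s L (<⇒≤ (≰⇒> t≰s)) desc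

  sortDesc-descending : ∀ L → Descending (sortDesc π L)
  sortDesc-descending []      = []
  sortDesc-descending (s ∷ L) = insertDesc-descending s (sortDesc π L) (sortDesc-descending L)

  insertDesc-↭ : ∀ s L → insertDesc π s L ↭ s ∷ L
  insertDesc-↭ s []      = ↭-refl
  insertDesc-↭ s (t ∷ L) with π t ≤? π s
  ... | yes _ = ↭-refl
  ... | no  _ = ↭-trans (↭-prep t (insertDesc-↭ s L)) (↭-swap t s ↭-refl)

  sortDesc-↭ : ∀ L → sortDesc π L ↭ L
  sortDesc-↭ []      = ↭-refl
  sortDesc-↭ (s ∷ L) = ↭-trans (insertDesc-↭ s (sortDesc π L)) (↭-prep s (sortDesc-↭ L))

  descending-head : ∀ {t L j} → Descending (t ∷ L) → j ∈ˡ t ∷ L → π j ≤ π t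
  descending-head desc = All.lookup (Linked⇒All (λ b≤a c≤b → ≤-trans c≤b b≤a) ≤-refl desc)

  Covers : Subset n → List (Fin n) → Set
  Covers A L = ∀ i → i ∉ A → i ∈ˡ L

  Above : Subset n → List (Fin n) → Set
  Above A L = ∀ {i j} → i ∈ A → j ∈ˡ L → π j ≤ π i

  covers-step : ∀ {A s L} → Covers A (s ∷ L) → Covers (A ∪ ⁅ s ⁆) L
  covers-step {s = s} covers i i∉A∪s with covers i (i∉A∪s ∘ x∈p∪q⁺ ∘ inj₁)
  ... | here refl = ⊥-elim (i∉A∪s (x∈p∪q⁺ (inj₂ (x∈⁅x⁆ s))))
  ... | there i∈L = i∈L

  covers-[]⇒⊤ : ∀ {A} → Covers A [] → A ≡ ⊤
  covers-[]⇒⊤ {A} covers = ⊆-antisym ⊆⊤ λ {i} _ → decidable-stable (i ∈? A) (λ i∉A → case covers i i∉A of λ ())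

  above-step : ∀ {A s L} → Descending (s ∷ L) → Above A (s ∷ L) → Above (A ∪ ⁅ s ⁆) L
  above-step {A} {s} desc above i∈A∪s j∈L with x∈p∪q⁻ A ⁅ s ⁆ i∈A∪s
  ... | inj₁ i∈A = above i∈A (there j∈L)
  ... | inj₂ i∈s rewrite x∈⁅y⁆⇒x≡y s i∈s = descending-head desc (there j∈L)

  level-cut : ∀ {A s L} → Above A (s ∷ L) → (∀ i → i ∉ A ∪ ⁅ s ⁆ → π i < π s) →
              UpperLevelSet π (π s) (A ∪ ⁅ s ⁆)
  level-cut {A} {s} above below i = mk⇔ to from
    where
    to : i ∈ A ∪ ⁅ s ⁆ → π s ≤ π i
    to i∈A∪s with x∈p∪q⁻ A ⁅ s ⁆ i∈A∪s
    ... | inj₁ i∈A = above i∈A (here refl)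
    ... | inj₂ i∈s = ≤-reflexive (cong π (sym (x∈⁅y⁆⇒x≡y s i∈s)))
    from : π s ≤ π i → i ∈ A ∪ ⁅ s ⁆
    from s≤i = decidable-stable (i ∈? A ∪ ⁅ s ⁆) (λ i∉A∪s → <⇒≱ (below i i∉A∪s) s≤i)

  hatGo-sub : ∀ (p q : Subset n → ℤ) A L →
              hatGo (λ Z → p Z - q Z) π A L ≡ hatGo p π A L - hatGo q π A L
  hatGo-sub p q A []          = refl
  hatGo-sub p q A (s ∷ [])    = distrib (p (A ∪ ⁅ s ⁆)) (q (A ∪ ⁅ s ⁆)) (π s)
    where distrib : ∀ a b c → (a - b) * c ≡ a * c - b * c
          distrib = solve-∀
  hatGo-sub p q A (s ∷ t ∷ L) = trans (cong (_+_ ((p A′ - q A′) * (π s - π t))) (hatGo-sub p q A′ (t ∷ L)))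
                                       (distrib (p A′) (q A′) (π s - π t) (hatGo p π A′ (t ∷ L)) (hatGo q π A′ (t ∷ L)))
    where A′ = A ∪ ⁅ s ⁆
          distrib : ∀ a b c x y → (a - b) * c + (x - y) ≡ (a * c + x) - (b * c + y)
          distrib = solve-∀

  hatGo-nonpos : ∀ (d : Subset n → ℤ) A L → Descending L → Covers A L →
                 (∀ Z → d Z ≤ + 0) → d ⊤ ≡ + 0 → hatGo d π A L ≤ + 0
  hatGo-nonpos d A []          _    _      _    _        = ≤-refl
  hatGo-nonpos d A (s ∷ [])    _    covers _    d[S]≡0 =
    ≤-reflexive (cong (_* π s) (trans (cong d (covers-[]⇒⊤ (covers-step covers))) d[S]≡0))
  hatGo-nonpos d A (s ∷ t ∷ L) (t≤s ∷ desc) covers d≤0 d[S]≡0 =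
    +-mono-≤ (*-monoʳ-≤-nonNeg (π s - π t) {{nonNegative (i≤j⇒0≤j-i t≤s)}} (d≤0 (A ∪ ⁅ s ⁆)))
             (hatGo-nonpos d (A ∪ ⁅ s ⁆) (t ∷ L) desc (covers-step covers) d≤0 d[S]≡0)

  hatGo-zero-on-levels : ∀ (d : Subset n → ℤ) A L → Descending L → Covers A L → Above A L →
                 (∀ c Z → UpperLevelSet π c Z → d Z ≡ + 0) → hatGo d π A L ≡ + 0
  hatGo-zero-on-levels d A []          _    _      _     _        = refl
  hatGo-zero-on-levels d A (s ∷ [])    _    covers above d[lev]≡0 =
    cong (_* π s) (d[lev]≡0 (π s) (A ∪ ⁅ s ⁆) (level-cut above λ i i∉A∪s → case covers-step covers i i∉A∪s of λ ()))
  hatGo-zero-on-levels d A (s ∷ t ∷ L) (t≤s ∷ desc) covers above d[lev]≡0 =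
    trans (cong₂ _+_ cut-term (hatGo-zero-on-levels d A′ (t ∷ L) desc (covers-step covers) (above-step (t≤s ∷ desc) above) d[lev]≡0))
          (+-identityʳ (+ 0))
    where
    A′ = A ∪ ⁅ s ⁆
    cut-term : d A′ * (π s - π t) ≡ + 0
    cut-term with π t ≟ℤ π s
    ... | yes t≡s = trans (cong (λ v → d A′ * (π s - v)) t≡s) (trans (cong (d A′ *_) (+-inverseʳ (π s))) (*-zeroʳ (d A′)))
    ... | no  t≢s = cong (_* (π s - π t)) (d[lev]≡0 (π s) A′ (level-cut above below))
      where below : ∀ i → i ∉ A′ → π i < π s
            below i i∉A′ = ≤-<-trans (descending-head desc (covers-step covers i i∉A′)) (≤∧≢⇒< t≤s t≢s)

  hatGo-modular : ∀ (x : Fin n → ℤ) A s L → Unique (s ∷ L) → All (_∉ A) (s ∷ L) →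
                  hatGo (λ Z → sumOver Z x) π A (s ∷ L) ≡ sumOver A x * π s + sumList (s ∷ L) (λ i → π i * x i)
  hatGo-modular x A s []      _ (s∉A ∷ []) = begin
    sumOver (A ∪ ⁅ s ⁆) x * π s             ≡⟨ cong (_* π s) (sumOver-∪⁅⁆ A x s∉A) ⟩
    (sumOver A x + x s) * π s               ≡⟨ expand (sumOver A x) (x s) (π s) ⟩
    sumOver A x * π s + (π s * x s + + 0)   ∎
    where open ≡-Reasoning
          expand : ∀ a b c → (a + b) * c ≡ a * c + (c * b + + 0)
          expand = solve-∀
  hatGo-modular x A s (t ∷ L) ((s≢t ∷ s≢L) ∷ unique) (s∉A ∷ L∉A) = begin
    X′ * (π s - π t) + hatGo (λ Z → sumOver Z x) π A′ (t ∷ L)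
      ≡⟨ cong (_+_ (X′ * (π s - π t))) (hatGo-modular x A′ t L unique (All.zipWith ∉A∪s (L∉A , s≢t ∷ s≢L))) ⟩
    X′ * (π s - π t) + (X′ * π t + rest)
      ≡⟨ cong (λ v → v * (π s - π t) + (v * π t + rest)) (sumOver-∪⁅⁆ A x s∉A) ⟩
    (sumOver A x + x s) * (π s - π t) + ((sumOver A x + x s) * π t + rest)
      ≡⟨ telescope (sumOver A x) (x s) (π s) (π t) rest ⟩
    sumOver A x * π s + (π s * x s + rest) ∎
    where
    open ≡-Reasoning
    A′ = A ∪ ⁅ s ⁆
    X′ = sumOver A′ x
    rest = sumList (t ∷ L) (λ i → π i * x i)
    ∉A∪s : ∀ {i} → i ∉ A × s ≢ i → i ∉ A′
    ∉A∪s (i∉A , s≢i) i∈A′ with x∈p∪q⁻ A ⁅ s ⁆ i∈A′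
    ... | inj₁ i∈A = i∉A i∈A
    ... | inj₂ i∈s = s≢i (sym (x∈⁅y⁆⇒x≡y s i∈s))
    telescope : ∀ a b c d r → (a + b) * (c - d) + ((a + b) * d + r) ≡ a * c + (c * b + r)
    telescope = solve-∀

  hatGo-modular-⊥ : ∀ (x : Fin n → ℤ) L → Unique L → hatGo (λ Z → sumOver Z x) π ⊥ L ≡ sumList L (λ i → π i * x i)
  hatGo-modular-⊥ x []      _      = refl
  hatGo-modular-⊥ x (s ∷ L) unique = begin
    hatGo (λ Z → sumOver Z x) π ⊥ (s ∷ L)           ≡⟨ hatGo-modular x ⊥ s L unique (All.tabulate (λ _ → ∉⊥)) ⟩
    sumOver ⊥ x * π s + sumList (s ∷ L) πx          ≡⟨ cong (λ v → v * π s + sumList (s ∷ L) πx) (sumOver-⊥ x) ⟩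
    + 0 + sumList (s ∷ L) πx                        ≡⟨ +-identityˡ (sumList (s ∷ L) πx) ⟩
    sumList (s ∷ L) πx                              ∎
    where open ≡-Reasoning
          πx = λ i → π i * x i

  order : List (Fin n)
  order = sortDesc π (allFin n)

  order-unique : Unique order
  order-unique = Unique-resp-↭ (↭⇒↭ₛ (↭-sym (sortDesc-↭ (allFin n)))) (allFin⁺ n)

  order-covers : Covers ⊥ order
  order-covers i _ = ∈-resp-↭ (↭-sym (sortDesc-↭ (allFin n))) (∈-allFin i)

  hatP-modular : ∀ (x : Fin n → ℤ) → hatP (λ Z → sumOver Z x) π ≡ sumAll (λ i → π i * x i)
  hatP-modular x = begin
    hatGo (λ Z → sumOver Z x) π ⊥ order ≡⟨ hatGo-modular-⊥ x order order-unique ⟩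
    sumList order (λ i → π i * x i)     ≡⟨ sumList-↭ (λ i → π i * x i) (sortDesc-↭ (allFin n)) ⟩
    sumList (allFin n) (λ i → π i * x i) ≡⟨ sumList-allFin (λ i → π i * x i) ⟩
    sumAll (λ i → π i * x i)            ∎
    where open ≡-Reasoning

  hatP-sub-modular : ∀ (p : Subset n → ℤ) x →
                     hatP (λ Z → p Z - sumOver Z x) π ≡ hatP p π - sumAll (λ i → π i * x i)
  hatP-sub-modular p x = trans (hatGo-sub p (λ Z → sumOver Z x) ⊥ order) (cong (_-_ (hatP p π)) (hatP-modular x))

  hatP≤ : ∀ (p : Subset n → ℤ) x → (∀ Z → p Z ≤ sumOver Z x) → p ⊤ ≡ sumAll x →
          hatP p π ≤ sumAll (λ i → π i * x i)
  hatP≤ p x p≤x p[S]≡x[S] = i-j≤0⇒i≤j (subst (_≤ + 0) (hatP-sub-modular p x)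
    (hatGo-nonpos (λ Z → p Z - sumOver Z x) ⊥ order (sortDesc-descending (allFin n)) order-covers
                  (λ Z → i≤j⇒i-j≤0 (p≤x Z)) (i≡j⇒i-j≡0 p[S]≡x[S])))

  hatP≡ : ∀ (p : Subset n → ℤ) x → (∀ c Z → UpperLevelSet π c Z → p Z ≡ sumOver Z x) →
          hatP p π ≡ sumAll (λ i → π i * x i)
  hatP≡ p x p≡x = i-j≡0⇒i≡j _ _ (trans (sym (hatP-sub-modular p x))
    (hatGo-zero-on-levels (λ Z → p Z - sumOver Z x) ⊥ order (sortDesc-descending (allFin n)) order-covers (⊥-elim ∘ ∉⊥)
                  (λ c Z level → i≡j⇒i-j≡0 (p≡x c Z level))))

-- Tight sets

Separates : ∀ {n} → (Subset n → Set) → Fin n → Fin n → Set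
Separates P i j = ∃ λ T → P T × i ∈ T × j ∉ T

module _ where
  open import Data.List.Relation.Unary.All using (All; []; _∷_)
  open import Data.List.Relation.Unary.Any using (Any; here; there)

  ∈-⋂⁺ : ∀ {n} {x : Fin n} Ts → All (x ∈_) Ts → x ∈ ⋂ Ts
  ∈-⋂⁺ []       []           = ∈⊤
  ∈-⋂⁺ (T ∷ Ts) (x∈T ∷ x∈Ts) = x∈p∩q⁺ (x∈T , ∈-⋂⁺ Ts x∈Ts)

  ∈-⋂⁻ : ∀ {n} {x : Fin n} Ts → x ∈ ⋂ Ts → All (x ∈_) Ts
  ∈-⋂⁻ []       _      = []
  ∈-⋂⁻ (T ∷ Ts) x∈⋂T∷Ts with x∈p∩q⁻ T (⋂ Ts) x∈⋂T∷Ts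
  ... | x∈T , x∈⋂Ts = x∈T ∷ ∈-⋂⁻ Ts x∈⋂Ts

  ∈-⋃⁺ : ∀ {n} {x : Fin n} Ts → Any (x ∈_) Ts → x ∈ ⋃ Ts
  ∈-⋃⁺ (T ∷ Ts) (here x∈T)   = x∈p∪q⁺ (inj₁ x∈T)
  ∈-⋃⁺ (T ∷ Ts) (there x∈Ts) = x∈p∪q⁺ (inj₂ (∈-⋃⁺ Ts x∈Ts))

  ∈-⋃⁻ : ∀ {n} {x : Fin n} Ts → x ∈ ⋃ Ts → Any (x ∈_) Ts
  ∈-⋃⁻ []       x∈⊥ = ⊥-elim (∉⊥ x∈⊥)
  ∈-⋃⁻ (T ∷ Ts) x∈⋃T∷Ts with x∈p∪q⁻ T (⋃ Ts) x∈⋃T∷Ts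
  ... | inj₁ x∈T   = here x∈T
  ... | inj₂ x∈⋃Ts = there (∈-⋃⁻ Ts x∈⋃Ts)

module SublatticeSeparation {n} (P : Subset n → Set) (P-⊥ : P ⊥) (P-⊤ : P ⊤)
         (P-∩ : ∀ {X Y} → P X → P Y → P (X ∩ Y)) (P-∪ : ∀ {X Y} → P X → P Y → P (X ∪ Y)) where
  open import Data.List.Relation.Unary.All using (All; []; _∷_)
  open import Data.List.Relation.Unary.Any using (Any; here; there)
  import Data.List.Relation.Unary.All.Properties as All
  import Data.List.Relation.Unary.Any.Properties as Any

  P-⋂ : ∀ {Ts} → All P Ts → P (⋂ Ts)
  P-⋂ []          = P-⊤
  P-⋂ (PT ∷ PTs) = P-∩ PT (P-⋂ PTs)

  P-⋃ : ∀ {Ts} → All P Ts → P (⋃ Ts)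
  P-⋃ []          = P-⊥
  P-⋃ (PT ∷ PTs) = P-∪ PT (P-⋃ PTs)

  -- Z is the union over i ∈ Z of the intersection of sets separating i from each j ∉ Z.
  separated⇒P : ∀ Z → (∀ {i j} → i ∈ Z → j ∉ Z → Separates P i j) → P Z
  separated⇒P Z separate =
    subst P (⊆-antisym ⋃cones⊆Z Z⊆⋃cones) (P-⋃ (All.tabulate⁺ λ i → P-⋂ (All.tabulate⁺ (cut-P i))))
    where
    cut : Fin n → Fin n → Subset n
    cut i j with i ∈? Z | j ∈? Z
    ... | no  _   | _       = ⊥
    ... | yes _   | yes _   = ⊤
    ... | yes i∈Z | no  j∉Z = proj₁ (separate i∈Z j∉Z)

    cut-P : ∀ i j → P (cut i j)
    cut-P i j with i ∈? Z | j ∈? Z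
    ... | no  _   | _       = P-⊥
    ... | yes _   | yes _   = P-⊤
    ... | yes i∈Z | no  j∉Z = proj₁ (proj₂ (separate i∈Z j∉Z))

    cut-∋ : ∀ {i} j → i ∈ Z → i ∈ cut i j
    cut-∋ {i} j i∈Z with i ∈? Z | j ∈? Z
    ... | no  i∉Z | _       = ⊥-elim (i∉Z i∈Z)
    ... | yes _   | yes _   = ∈⊤
    ... | yes i∈Z | no  j∉Z = proj₁ (proj₂ (proj₂ (separate i∈Z j∉Z)))

    cut-∌ : ∀ {i j} → j ∈ cut i j → j ∈ Z
    cut-∌ {i} {j} j∈cut with i ∈? Z | j ∈? Z
    ... | no  _   | _       = ⊥-elim (∉⊥ j∈cut)
    ... | yes _   | yes j∈Z = j∈Z
    ... | yes i∈Z | no  j∉Z = ⊥-elim (proj₂ (proj₂ (proj₂ (separate i∈Z j∉Z))) j∈cut)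

    cone : Fin n → Subset n
    cone i = ⋂ (tabulate (cut i))

    ⋃cones⊆Z : ⋃ (tabulate cone) ⊆ Z
    ⋃cones⊆Z {x} x∈⋃ =
      let i , x∈cone = Any.tabulate⁻ (∈-⋃⁻ (tabulate cone) x∈⋃)
      in cut-∌ {i} (All.tabulate⁻ (∈-⋂⁻ (tabulate (cut i)) x∈cone) x)

    Z⊆⋃cones : Z ⊆ ⋃ (tabulate cone)
    Z⊆⋃cones {x} x∈Z =
      ∈-⋃⁺ (tabulate cone) (Any.tabulate⁺ x (∈-⋂⁺ (tabulate (cut x)) (All.tabulate⁺ λ j → cut-∋ j x∈Z)))

Tight : ∀ {n} → (Subset n → ℤ) → (Fin n → ℤ) → Subset n → Set
Tight p x Z = p Z ≡ sumOver Z x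

separates? : ∀ {n} (p : Subset n → ℤ) x i j → Dec (Separates (Tight p x) i j)
separates? p x i j = anySubset? λ T → (p T ≟ℤ sumOver T x) ×-dec (i ∈? T) ×-dec ¬? (j ∈? T)

module TightSets {n} {p : Subset n → ℤ} (superMod : Supermodular p) (p[∅]≡0 : p ⊥ ≡ + 0)
                 {x : Fin n → ℤ} (x∈B : InB' p x) where

  private
    lowerBound = InB'⇒lowerBound x∈B

    squeezed : ∀ {X Y} → Tight p x X → Tight p x Y →
               sumOver (X ∩ Y) x + sumOver (X ∪ Y) x ≤ p (X ∩ Y) + p (X ∪ Y)
    squeezed {X} {Y} tightX tightY = begin
      sumOver (X ∩ Y) x + sumOver (X ∪ Y) x ≡⟨ sym (sumOver-modular X Y x) ⟩
      sumOver X x + sumOver Y x             ≡⟨ sym (cong₂ _+_ tightX tightY) ⟩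
      p X + p Y                             ≤⟨ superMod X Y ⟩
      p (X ∩ Y) + p (X ∪ Y)                 ∎
      where open ≤-Reasoning

  tight-∩ : ∀ {X Y} → Tight p x X → Tight p x Y → Tight p x (X ∩ Y)
  tight-∩ {X} {Y} tightX tightY = +-squeeze (lowerBound (X ∩ Y)) (lowerBound (X ∪ Y)) (squeezed tightX tightY)

  tight-∪ : ∀ {X Y} → Tight p x X → Tight p x Y → Tight p x (X ∪ Y)
  tight-∪ {X} {Y} tightX tightY = +-squeeze (lowerBound (X ∪ Y)) (lowerBound (X ∩ Y))
    (subst₂ _≤_ (+-comm (sumOver (X ∩ Y) x) _) (+-comm (p (X ∩ Y)) _) (squeezed tightX tightY))

  tight-⊥ : Tight p x ⊥
  tight-⊥ = trans p[∅]≡0 (sym (sumOver-⊥ x))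

  tight-⊤ : Tight p x ⊤
  tight-⊤ = sym (proj₁ x∈B)

  open SublatticeSeparation (Tight p x) tight-⊥ tight-⊤ tight-∩ tight-∪ public
    using () renaming (separated⇒P to separated⇒tight)

  separates-split : ∀ {i j l} → Separates (Tight p x) i l → Separates (Tight p x) i j ⊎ Separates (Tight p x) j l
  separates-split {j = j} (T , tightT , i∈T , l∉T) with j ∈? T
  ... | yes j∈T = inj₂ (T , tightT , j∈T , l∉T)
  ... | no  j∉T = inj₁ (T , tightT , i∈T , j∉T)

-- Local search and the odd dual vector

module LocalSearch {n} {p : Subset n → ℤ} where

  LocallyOptimal : (Fin n → ℤ) → Set
  LocallyOptimal m = ∀ i j → m j + + 1 < m i → Separates (Tight p m) i j

  transfer : Fin n → Fin n → (Fin n → ℤ) → Fin n → ℤ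
  transfer i j m v = m v + single j (+ 1) v + single i (- + 1) v

  sumOver-transfer : ∀ i j m Z → sumOver Z (transfer i j m) ≡ sumOver Z m + sumOver Z (single j (+ 1)) + sumOver Z (single i (- + 1))
  sumOver-transfer i j m Z = begin
    sumOver Z (transfer i j m) ≡⟨ sumOver-+ Z (λ v → m v + single j (+ 1) v) (single i (- + 1)) ⟩
    sumOver Z (λ v → m v + single j (+ 1) v) + sumOver Z (single i (- + 1))
      ≡⟨ cong (_+ sumOver Z (single i (- + 1))) (sumOver-+ Z m (single j (+ 1))) ⟩
    sumOver Z m + sumOver Z (single j (+ 1)) + sumOver Z (single i (- + 1)) ∎
    where open ≡-Reasoning

  transfer-∈B' : ∀ {i j m} → InB' p m → ¬ Separates (Tight p m) i j → InB' p (transfer i j m)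
  transfer-∈B' {i} {j} {m} m∈B ¬sep = total , λ Z _ → lowerBound Z
    where
    total : sumAll (transfer i j m) ≡ p ⊤
    total = begin
      sumAll (transfer i j m)                                                 ≡⟨ sumOver-transfer i j m ⊤ ⟩
      sumAll m + sumOver ⊤ (single j (+ 1)) + sumOver ⊤ (single i (- + 1))
        ≡⟨ cong₂ (λ a b → sumAll m + a + b) (sumOver-single-∈ ⊤ {j} (+ 1) ∈⊤) (sumOver-single-∈ ⊤ {i} (- + 1) ∈⊤) ⟩
      sumAll m + + 1 + - + 1                                                  ≡⟨ +-assoc (sumAll m) (+ 1) (- + 1) ⟩
      sumAll m + + 0                                                          ≡⟨ +-identityʳ (sumAll m) ⟩
      sumAll m                                                                ≡⟨ proj₁ m∈B ⟩
      p ⊤                                                                     ∎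
      where open ≡-Reasoning
    lowerBound : ∀ Z → p Z ≤ sumOver Z (transfer i j m)
    lowerBound Z = subst (p Z ≤_) (sym (sumOver-transfer i j m Z)) (bound (j ∈? Z) (i ∈? Z))
      where
      x = sumOver Z m
      x≥p = InB'⇒lowerBound m∈B Z
      bound : Dec (j ∈ Z) → Dec (i ∈ Z) → p Z ≤ x + sumOver Z (single j (+ 1)) + sumOver Z (single i (- + 1))
      bound (yes j∈Z) (yes i∈Z) rewrite sumOver-single-∈ Z (+ 1) j∈Z | sumOver-single-∈ Z (- + 1) i∈Z =
        subst (p Z ≤_) (sym (trans (+-assoc x (+ 1) (- + 1)) (+-identityʳ x))) x≥p
      bound (yes j∈Z) (no i∉Z)  rewrite sumOver-single-∈ Z (+ 1) j∈Z | sumOver-single-∉ Z (- + 1) i∉Z =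
        ≤-trans x≥p (≤-trans (i≤i+j x (+ 1)) (≤-reflexive (sym (+-identityʳ (x + + 1)))))
      bound (no j∉Z)  (no i∉Z)  rewrite sumOver-single-∉ Z (+ 1) j∉Z | sumOver-single-∉ Z (- + 1) i∉Z =
        subst (p Z ≤_) (sym (trans (+-identityʳ (x + + 0)) (+-identityʳ x))) x≥p
      bound (no j∉Z)  (yes i∈Z) rewrite sumOver-single-∉ Z (+ 1) j∉Z | sumOver-single-∈ Z (- + 1) i∈Z =
        subst (p Z ≤_) (pred≡ x) (i<j⇒i≤pred[j] (≤∧≢⇒< x≥p λ tight → ¬sep (Z , tight , i∈Z , j∉Z)))
        where pred≡ : ∀ a → - + 1 + a ≡ a + + 0 + - + 1
              pred≡ = solve-∀

  sumSq-transfer : ∀ {i j} m → i ≢ j → sumSq (transfer i j m) ≡ sumSq m + (+ 2 * m j + + 1) + (+ 1 - + 2 * m i)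
  sumSq-transfer {i} {j} m i≢j = begin
    sumSq (transfer i j m)                                        ≡⟨ sumOver-cong ⊤ square-transfer ⟩
    sumAll (λ v → m v * m v + single j cj v + single i ci v)
      ≡⟨ sumOver-+ ⊤ (λ v → m v * m v + single j cj v) (single i ci) ⟩
    sumAll (λ v → m v * m v + single j cj v) + sumAll (single i ci)
      ≡⟨ cong (_+ sumAll (single i ci)) (sumOver-+ ⊤ (λ v → m v * m v) (single j cj)) ⟩
    sumSq m + sumAll (single j cj) + sumAll (single i ci)
      ≡⟨ cong₂ (λ a b → sumSq m + a + b) (sumOver-single-∈ ⊤ {j} cj ∈⊤) (sumOver-single-∈ ⊤ {i} ci ∈⊤) ⟩
    sumSq m + cj + ci
      ∎
    where
    open ≡-Reasoning
    cj = + 2 * m j + + 1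
    ci = + 1 - + 2 * m i
    square-transfer : ∀ v → transfer i j m v * transfer i j m v ≡ m v * m v + single j cj v + single i ci v
    square-transfer v with v ≟ j | v ≟ i
    ... | yes refl | yes refl = ⊥-elim (i≢j refl)
    ... | yes refl | no  _    = gain (m v)
      where gain : ∀ a → (a + + 1 + + 0) * (a + + 1 + + 0) ≡ a * a + (+ 2 * a + + 1) + + 0
            gain = solve-∀
    ... | no  _    | yes refl = loss (m v)
      where loss : ∀ a → (a + + 0 + - + 1) * (a + + 0 + - + 1) ≡ a * a + + 0 + (+ 1 - + 2 * a)
            loss = solve-∀
    ... | no  _    | no  _    = same (m v)
      where same : ∀ a → (a + + 0 + + 0) * (a + + 0 + + 0) ≡ a * a + + 0 + + 0
            same = solve-∀

  transfer-decreases : ∀ {i j} m → m j + + 1 < m i → sumSq (transfer i j m) < sumSq m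
  transfer-decreases {i} {j} m mj+1<mi =
    subst (_< sumSq m) (sym (sumSq-transfer m i≢j)) (decrease (sumSq m) (m i) (m j) mj+1<mi)
    where
    i≢j : i ≢ j
    i≢j refl = <-irrefl refl (≤-<-trans (i≤i+j (m i) (+ 1)) mj+1<mi)
    decrease : ∀ S a b → b + + 1 < a → S + (+ 2 * b + + 1) + (+ 1 - + 2 * a) < S
    decrease S a b b+1<a = suc[i]≤j⇒i<j (begin
      + 1 + (S + (+ 2 * b + + 1) + (+ 1 - + 2 * a))      ≡⟨ solve (S ∷ a ∷ b ∷ []) ⟩
      S - (+ 2 * (a - (+ 1 + (b + + 1))) + + 1)          ≤⟨ i≤j⇒i-k≤j _ {{nonNegative 0≤2g+1}} ≤-refl ⟩
      S                                                  ∎)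
      where
      open ≤-Reasoning
      0≤g : + 0 ≤ a - (+ 1 + (b + + 1))
      0≤g = i≤j⇒0≤j-i (i<j⇒suc[i]≤j b+1<a)
      0≤2g+1 : + 0 ≤ + 2 * (a - (+ 1 + (b + + 1))) + + 1
      0≤2g+1 = ≤-trans (0≤i∧0≤j⇒0≤i*j {+ 2} (+≤+ N.z≤n) 0≤g) (i≤i+j _ (+ 1))

  improvable? : ∀ m → Dec (∃ λ i → ∃ λ j → m j + + 1 < m i × ¬ Separates (Tight p m) i j)
  improvable? m = any? λ i → any? λ j → (m j + + 1 <? m i) ×-dec ¬? (separates? p m i j)

  local-optimum-below : ∀ k m → InB' p m → sumSq m < + k → Σ (Fin n → ℤ) λ m* → InB' p m* × LocallyOptimal m*
  local-optimum-below N.zero    m _   sumSq<0   = ⊥-elim (<⇒≱ sumSq<0 (sumSq-nonneg m))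
  local-optimum-below (N.suc k) m m∈B sumSq≤k with improvable? m
  ... | yes (i , j , mj+1<mi , ¬sep) =
    local-optimum-below k (transfer i j m) (transfer-∈B' m∈B ¬sep) (<-≤-trans (transfer-decreases m mj+1<mi) (i<suc[j]⇒i≤j sumSq≤k))
  ... | no ¬improvable =
    m , m∈B , λ i j mj+1<mi → decidable-stable (separates? p m i j) λ ¬sep → ¬improvable (i , j , mj+1<mi , ¬sep)

  local-optimum : ∀ {m₀} → InB' p m₀ → Σ (Fin n → ℤ) λ m → InB' p m × LocallyOptimal m
  local-optimum {m₀} m₀∈B = local-optimum-below (N.suc ∣ sumSq m₀ ∣) m₀ m₀∈B
    (subst (_< + N.suc ∣ sumSq m₀ ∣) (0≤i⇒+∣i∣≡i (sumSq-nonneg m₀)) (+<+ (n<1+n ∣ sumSq m₀ ∣)))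

module OddDual {n} {p : Subset n → ℤ} (superMod : Supermodular p) (p[∅]≡0 : p ⊥ ≡ + 0)
               {m : Fin n → ℤ} (m∈B : InB' p m) (optimal : LocalSearch.LocallyOptimal {p = p} m) where
  open TightSets superMod p[∅]≡0 m∈B

  Sep : Fin n → Fin n → Set
  Sep = Separates (Tight p m)

  High : Fin n → Set
  High i = ∀ j → m j < m i → Sep i j

  high? : ∀ i → Dec (High i)
  high? i = all? λ j → (m j <? m i) →-dec separates? p m i j

  dual : Fin n → ℤ
  dual i with high? i
  ... | yes _ = + 2 * m i + + 1
  ... | no  _ = + 2 * m i - + 1

  dual-shape : ∀ i → dual i ≡ + 2 * m i + + 1 ⊎ dual i ≡ + 2 * m i - + 1
  dual-shape i with high? i
  ... | yes _ = inj₁ refl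
  ... | no  _ = inj₂ refl

  ¬high⇒witness : ∀ {j} → ¬ High j → ∃ λ l → m l < m j × ¬ Sep j l
  ¬high⇒witness {j} ¬high with ¬∀⟶∃¬ n _ (λ l → (m l <? m j) →-dec separates? p m j l) ¬high
  ... | l , ¬[ml<mj→sep] =
    l , decidable-stable (m l <? m j) (λ ml≮mj → ¬[ml<mj→sep] (⊥-elim ∘ ml≮mj)) , ¬[ml<mj→sep] ∘ const

  ¬sep-trans : ∀ {i j l} → ¬ Sep i j → ¬ Sep j l → ¬ Sep i l
  ¬sep-trans ¬sepij ¬sepjl sepil with separates-split sepil
  ... | inj₁ sepij = ¬sepij sepij
  ... | inj₂ sepjl = ¬sepjl sepjl

  ¬sep⇒≤+1 : ∀ {i j} → ¬ Sep i j → m i ≤ m j + + 1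
  ¬sep⇒≤+1 {i} {j} ¬sep = ≮⇒≥ (¬sep ∘ optimal i j)

  high∧¬sep⇒≤ : ∀ {i j} → High i → ¬ Sep i j → m i ≤ m j
  high∧¬sep⇒≤ {j = j} high ¬sep = ≮⇒≥ (¬sep ∘ high j)

  dual-mono : ∀ {i j} → ¬ Sep i j → dual i ≤ dual j
  dual-mono {i} {j} ¬sep with high? i | high? j
  ... | yes highi | yes _    = 2a+c≤2b+c (high∧¬sep⇒≤ highi ¬sep) (+ 1)
  ... | no  _     | yes _    = 2a-1≤2b+1 {b = m j} (¬sep⇒≤+1 ¬sep)
  ... | yes highi | no ¬highj =
    let l , ml<mj , ¬sepjl = ¬high⇒witness ¬highj
    in 2a+1≤2b-1 (≤-<-trans (high∧¬sep⇒≤ highi (¬sep-trans ¬sep ¬sepjl)) ml<mj)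
  ... | no  _     | no ¬highj =
    let l , ml<mj , ¬sepjl = ¬high⇒witness ¬highj
    in 2a+c≤2b+c (≤-trans (¬sep⇒≤+1 (¬sep-trans ¬sep ¬sepjl)) (i<j⇒i+1≤j ml<mj)) (- + 1)

  dual-order : ∀ {i j} → dual j < dual i → Sep i j
  dual-order {i} {j} dj<di = decidable-stable (separates? p m i j) (λ ¬sep → <⇒≱ dj<di (dual-mono ¬sep))

  upperLevel-tight : ∀ c Z → UpperLevelSet dual c Z → Tight p m Z
  upperLevel-tight c Z level = separated⇒tight Z λ {i} {j} i∈Z j∉Z →
    dual-order (<-≤-trans (≰⇒> (j∉Z ∘ Equivalence.from (level j))) (Equivalence.to (level i) i∈Z))

  dual-odd : OddVec dual
  dual-odd i with dual-shape i
  ... | inj₁ dual≡2m+1 = m i , dual≡2m+1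
  ... | inj₂ dual≡2m-1 = m i - + 1 , trans dual≡2m-1 (odd-shift (m i))
    where odd-shift : ∀ a → + 2 * a - + 1 ≡ + 2 * (a - + 1) + + 1
          odd-shift = solve-∀

  strong-duality : sumSq m ≡ val2 p dual
  strong-duality = begin
    sumSq m                                   ≡⟨ sym ([a+b]-b≡a (sumSq m) Q) ⟩
    sumSq m + Q - Q                           ≡⟨ cong (_- Q) (sym (sumOver-+ ⊤ (λ i → m i * m i) (λ i → quarterSqM1 (dual i)))) ⟩
    sumAll (λ i → m i * m i + quarterSqM1 (dual i)) - Q
      ≡⟨ cong (_- Q) (sumOver-cong ⊤ λ i → sym ([2a±1]*a≡a*a+quarterSqM1 (m i) (dual i) (dual-shape i))) ⟩
    sumAll (λ i → dual i * m i) - Q           ≡⟨ cong (_- Q) (sym complementary-slackness) ⟩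
    val2 p dual                               ∎
    where
    open ≡-Reasoning
    Q = sumAll (λ i → quarterSqM1 (dual i))
    complementary-slackness : hatP p dual ≡ sumAll (λ i → dual i * m i)
    complementary-slackness = LinearExtension.hatP≡ dual p m upperLevel-tight

weak-duality : ∀ {n} {p : Subset n → ℤ} {x} → InB' p x → ∀ π → val1 p π ≤ sumSq x
weak-duality {p = p} {x} x∈B π = begin
  hatP p π - F
    ≤⟨ +-monoˡ-≤ (- F) (LinearExtension.hatP≤ π p x (InB'⇒lowerBound x∈B) (sym (proj₁ x∈B))) ⟩
  sumAll (λ i → π i * x i) - F
    ≤⟨ +-monoˡ-≤ (- F) (sumOver-mono ⊤ λ i → product≤square+floorHalf*ceilHalf (π i) (x i)) ⟩
  sumAll (λ i → x i * x i + floorHalf (π i) * ceilHalf (π i)) - F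
    ≡⟨ cong (_- F) (sumOver-+ ⊤ (λ i → x i * x i) (λ i → floorHalf (π i) * ceilHalf (π i))) ⟩
  sumSq x + F - F
    ≡⟨ [a+b]-b≡a (sumSq x) F ⟩
  sumSq x
    ∎
  where
  open ≤-Reasoning
  F = sumAll (λ i → floorHalf (π i) * ceilHalf (π i))

val2≡val1 : ∀ {n} (p : Subset n → ℤ) {π} → OddVec π → val2 p π ≡ val1 p π
val2≡val1 p {π} odd = cong (_-_ (hatP p π)) (sumOver-cong ⊤ λ i → sym (floorHalf*ceilHalf≡quarterSqM1 (odd i)))

corollary6p19 : (n : ℕ) → 1 N.≤ n → (p : Subset n → ℤ) → Supermodular p → p ⊥ ≡ + 0 →
    Σ (Fin n → ℤ) λ m → Σ (Fin n → ℤ) λ π →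
      InB' p m × OddVec π
      × (∀ m′ → InB' p m′ → sumSq m ≤ sumSq m′)
      × (∀ π′ → val1 p π′ ≤ val1 p π)
      × (∀ π′ → OddVec π′ → val2 p π′ ≤ val2 p π)
      × (sumSq m ≡ val1 p π)
      × (sumSq m ≡ val2 p π)
corollary6p19 n _ p superMod p[∅]≡0 with LocalSearch.local-optimum (proj₂ (B'-nonempty p superMod p[∅]≡0))
... | m , m∈B , optimal =
  m , dual , m∈B , dual-odd , minimal , maximal , maximal-odd , sumSq≡val1 , strong-duality
  where
  open OddDual superMod p[∅]≡0 m∈B optimal
  sumSq≡val1 : sumSq m ≡ val1 p dual
  sumSq≡val1 = trans strong-duality (val2≡val1 p dual-odd)
  minimal : ∀ m′ → InB' p m′ → sumSq m ≤ sumSq m′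
  minimal m′ m′∈B = subst (_≤ sumSq m′) (sym sumSq≡val1) (weak-duality m′∈B dual)
  maximal : ∀ π′ → val1 p π′ ≤ val1 p dual
  maximal π′ = subst (val1 p π′ ≤_) sumSq≡val1 (weak-duality m∈B π′)
  maximal-odd : ∀ π′ → OddVec π′ → val2 p π′ ≤ val2 p dual
  maximal-odd π′ odd′ = subst₂ _≤_ (sym (val2≡val1 p odd′)) strong-duality (weak-duality m∈B π′)
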